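{- For every indexed forest $F$, the following identity holds in the formal power series ring $\mathbb{Q}[[x_1,x_2,\dots]]$: $$\mathfrak{P}_F=\sum_{L}(-1)^{|L|}\sum_{\kappa\ L\text{ -compatible}}\ \prod_{v\in\operatorname{IN}(F)}x_{\kappa(v)},$$ where $L$ ranges over all lower order ideals of $\operatorname{IN}(F)$ and $\kappa$ over all $L$-compatible labelings $\kappa:\operatorname{IN}(F)\to\mathbb{Z}_{>0}$.
   Context: An indexed forest $F$ with finite support $S\subset\mathbb{Z}$ (maximal consecutive blocks $I_1<\cdots<I_k$) consists of plane binary trees $T_j$ with $|I_j|$ nodes, canonically labeled by the elements of $I_j$ in inorder. Missing children are leaves. $\operatorname{IN}(F)$ is the set of nodes. $\rho_F(v)$ is the canonical label of the node reached from $v$ by following left children as long as possible. The forest polynomial is $\mathfrak{P}_F=\sum_\kappa\prod_vx_{\kappa(v)}$ over $\kappa:\operatorname{IN}(F)\to\mathbb{Z}_{\ge1}$ with $\kappa(v)\le\rho_F(v)$, $\kappa(\text{left child of }u)\ge\kappa(u)$, and $\kappa(\text{right child of }u)>\kappa(u)$; it is $1$ for the empty forest. $\operatorname{IN}(F)$ is a poset in which each node is greater than its children (roots are maximal). A lower order ideal $L$ is a subset closed under taking children; let $U=\operatorname{IN}(F)\setminus L$. A labeling $\kappa:\operatorname{IN}(F)\to\mathbb{Z}_{>0}$ is $L$-compatible if the following hold. (1) For every edge with both endpoints $u$ (parent) and $v$ (child) in $U$: $\kappa(v)\ge\kappa(u)$ if $v$ is a left child and $\kappa(v)>\kappa(u)$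 if $v$ is a right child. (2) For every edge with both endpoints in $L$: $\kappa(v)<\kappa(u)$ if $v$ is a left child and $\kappa(v)\le\kappa(u)$ if $v$ is a right child. (3) $\kappa(v)>\rho_F(v)$ for every $v\in L$. No condition is imposed on edges joining $L$ and $U$. -}

module Defs where

open import Data.Bool using (Bool; true; false; _∧_; _∨_; not; if_then_else_)
open import Data.Nat using (ℕ; zero; suc; _≤ᵇ_; _<ᵇ_; _≡ᵇ_)
open import Data.Integer as ℤ using (ℤ; +_; +0)
open import Data.List using (List; []; _∷_; map; concatMap; applyUpTo; length; _++_)
open import Data.Product using (_×_; _,_)
open import Data.Unit using (⊤)
open import Data.Empty using (⊥)
open import Relation.Nullary using (does)

-- Plane binary trees (leaf = missing child, node = internal node)

data Tree : Set where
  leaf : Tree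
  node : Tree → Tree → Tree

size : Tree → ℕ
size leaf = 0
size (node l r) = suc (size l Data.Nat.+ size r)

data Deco (A : Set) : Tree → Set where
  lf : Deco A leaf
  nd : ∀ {l r} → Deco A l → A → Deco A r → Deco A (node l r)

-- Indexed forests: a list of blocks (s , T) meaning the tree T whose
-- |T| nodes are labelled by the consecutive integers s, s+1, ..., s+|T|-1
-- in inorder.  Blocks are nonempty, listed left to right, and maximal
-- (consecutive blocks are separated by a gap).

RawForest : Set
RawForest = List (ℤ × Tree)

NonEmptyTree : Tree → Set
NonEmptyTree leaf = ⊥
NonEmptyTree (node _ _) = ⊤

GapBefore : ℤ → Tree → RawForest → Set
GapBefore s t [] = ⊤
GapBefore s t ((s' , _) ∷ _) = s ℤ.+ (+ size t) ℤ.< s'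

IsIndexedForest : RawForest → Set
IsIndexedForest [] = ⊤
IsIndexedForest ((s , t) ∷ F) = NonEmptyTree t × GapBefore s t F × IsIndexedForest F

data FDeco (A : Set) : RawForest → Set where
  []  : FDeco A []
  _∷_ : ∀ {s t F} → Deco A t → FDeco A F → FDeco A ((s , t) ∷ F)

canon : ℤ → (t : Tree) → Deco ℤ t
canon s leaf = lf
canon s (node l r) = nd (canon s l) (s ℤ.+ (+ size l)) (canon (s ℤ.+ (+ suc (size l))) r)

leftmost : ∀ {A l r} → Deco A (node l r) → A
leftmost (nd lf a _) = a
leftmost (nd (nd x b y) a _) = leftmost (nd x b y)

leftChain : ∀ {A t} → Deco A t → Deco A t
leftChain lf = lf
leftChain (nd l a r) = nd (leftChain l) (leftmost (nd l a r)) (leftChain r)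

rhoF : (F : RawForest) → FDeco ℤ F
rhoF [] = []
rhoF ((s , t) ∷ F) = leftChain (canon s t) ∷ rhoF F

allDeco : ∀ {A} → List A → (t : Tree) → List (Deco A t)
allDeco vs leaf = lf ∷ []
allDeco vs (node l r) =
  concatMap (λ dl → concatMap (λ a → map (λ dr → nd dl a dr) (allDeco vs r)) vs) (allDeco vs l)

allFDeco : ∀ {A} → List A → (F : RawForest) → List (FDeco A F)
allFDeco vs [] = [] ∷ []
allFDeco vs ((s , t) ∷ F) = concatMap (λ d → map (λ ds → d ∷ ds) (allFDeco vs F)) (allDeco vs t)

valuesT : ∀ {A t} → Deco A t → List A
valuesT lf = []
valuesT (nd l a r) = valuesT l ++ (a ∷ valuesT r)

valuesF : ∀ {A F} → FDeco A F → List A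
valuesF [] = []
valuesF (d ∷ ds) = valuesT d ++ valuesF ds

countB : ∀ {A : Set} → (A → Bool) → List A → ℕ
countB p [] = 0
countB p (x ∷ xs) = if p x then suc (countB p xs) else countB p xs

eqListℕ : List ℕ → List ℕ → Bool
eqListℕ [] [] = true
eqListℕ (x ∷ xs) (y ∷ ys) = (x ≡ᵇ y) ∧ eqListℕ xs ys
eqListℕ _ _ = false

-- Formal power series in x_1, x_2, ... (integer coefficients), given by
-- their coefficients.  A monomial x_1^{α_1} ⋯ x_N^{α_N} is represented by the
-- exponent list α = (α_1, …, α_N).
-- The labeling κ (values in ℤ_{>0}) contributes the monomial ∏_v x_{κ(v)};
-- expVec N κ is its exponent list w.r.t. x_1 … x_N.

expVec : ℕ → List ℕ → List ℕ
expVec N vals = map (λ i → countB (λ v → v ≡ᵇ i) vals) (applyUpTo suc N)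

-- Coefficient of x^α in  Σ_{κ : IN(F) → ℤ_{>0}, P κ} ∏_v x_{κ(v)}.
-- Only labelings with values in {1,…,N}, N = length α, can produce x^α.
coeff : (F : RawForest) → (FDeco ℕ F → Bool) → List ℕ → ℕ
coeff F P α =
  countB (λ κ → P κ ∧ eqListℕ (expVec (length α) (valuesF κ)) α)
         (allFDeco (applyUpTo suc (length α)) F)

_≤ℤ_ : ℤ → ℤ → Bool
x ≤ℤ y = does (x ℤ.≤? y)

_<ℤ_ : ℤ → ℤ → Bool
x <ℤ y = does (x ℤ.<? y)

leftGE : ∀ {t} → ℕ → Deco ℕ t → Bool
leftGE a lf = true
leftGE a (nd _ a' _) = a ≤ᵇ a'

rightGT : ∀ {t} → ℕ → Deco ℕ t → Bool
rightGT a lf = true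
rightGT a (nd _ a' _) = a <ᵇ a'

forestCondT : ∀ {t} → Deco ℕ t → Deco ℤ t → Bool
forestCondT lf lf = true
forestCondT (nd kl a kr) (nd ρl ρv ρr) =
  ((+ a) ≤ℤ ρv) ∧ leftGE a kl ∧ rightGT a kr ∧ forestCondT kl ρl ∧ forestCondT kr ρr

forestCondF : ∀ {F} → FDeco ℕ F → FDeco ℤ F → Bool
forestCondF [] [] = true
forestCondF (k ∷ ks) (ρ ∷ ρs) = forestCondT k ρ ∧ forestCondF ks ρs

-- the labelings κ summed over in 𝔓_F
forestCond : (F : RawForest) → FDeco ℕ F → Bool
forestCond F κ = forestCondF κ (rhoF F)

-- Lower order ideals, encoded as markings (true = node in L)

childInL : ∀ {t} → Deco Bool t → Bool
childInL lf = true
childInL (nd _ b _) = b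

isIdealT : ∀ {t} → Deco Bool t → Bool
isIdealT lf = true
isIdealT (nd ml b mr) = (not b ∨ (childInL ml ∧ childInL mr)) ∧ isIdealT ml ∧ isIdealT mr

isIdealF : ∀ {F} → FDeco Bool F → Bool
isIdealF [] = true
isIdealF (m ∷ ms) = isIdealT m ∧ isIdealF ms

filterB : ∀ {A : Set} → (A → Bool) → List A → List A
filterB p [] = []
filterB p (x ∷ xs) = if p x then x ∷ filterB p xs else filterB p xs

lowerIdeals : (F : RawForest) → List (FDeco Bool F)
lowerIdeals F = filterB isIdealF (allFDeco (true ∷ false ∷ []) F)

card : ∀ {F} → FDeco Bool F → ℕ
card L = countB (λ b → b) (valuesF L)

sign : ℕ → ℤ
sign zero = + 1
sign (suc n) = ℤ.- sign n

leftEdge : ∀ {t} → Bool → ℕ → Deco Bool t → Deco ℕ t → Bool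
leftEdge b a lf lf = true
leftEdge false a (nd _ false _) (nd _ a' _) = a ≤ᵇ a'
leftEdge true  a (nd _ true  _) (nd _ a' _) = a' <ᵇ a
leftEdge _ _ _ _ = true

rightEdge : ∀ {t} → Bool → ℕ → Deco Bool t → Deco ℕ t → Bool
rightEdge b a lf lf = true
rightEdge false a (nd _ false _) (nd _ a' _) = a <ᵇ a'
rightEdge true  a (nd _ true  _) (nd _ a' _) = a' ≤ᵇ a
rightEdge _ _ _ _ = true

compatT : ∀ {t} → Deco Bool t → Deco ℕ t → Deco ℤ t → Bool
compatT lf lf lf = true
compatT (nd ml b mr) (nd kl a kr) (nd ρl ρv ρr) =
  (not b ∨ (ρv <ℤ (+ a)))
  ∧ leftEdge b a ml kl ∧ rightEdge b a mr kr
  ∧ compatT ml kl ρl ∧ compatT mr kr ρr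

compatF : ∀ {F} → FDeco Bool F → FDeco ℕ F → FDeco ℤ F → Bool
compatF [] [] [] = true
compatF (m ∷ ms) (k ∷ ks) (ρ ∷ ρs) = compatT m k ρ ∧ compatF ms ks ρs

compatible : (F : RawForest) → FDeco Bool F → FDeco ℕ F → Bool
compatible F L κ = compatF L κ (rhoF F)

sumℤ : List ℤ → ℤ
sumℤ [] = +0
sumℤ (x ∷ xs) = x ℤ.+ sumℤ xs

-- Fix a labelling κ. The coefficient identity is the sum over κ of the pointwise identity
--   [κ satisfies the conditions of 𝔓_F] = Σ_L (-1)^|L| [κ is L-compatible],
-- whose right-hand side factors over the trees of F. For one tree it is computed by recursion,
-- splitting on whether the root lies in L. If it does, L contains the whole tree, and
-- L-compatibility then forces κ(root) above every canonical label of the tree. Consequently,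
-- when κ(root) ≤ ρ(root) the terms with the root in L vanish and each subtree contributes
-- exactly the 𝔓_F-conditions on it and on its edge to the root, while when κ(root) > ρ(root)
-- the terms with the root in L cancel those with the root outside L.

module Submission where

open import Defs
open import Data.Integer using (ℤ; +_; _*_)
open import Data.List using (List; map)
open import Data.Nat using (ℕ)
open import Relation.Binary.PropositionalEquality using (_≡_)

open import Data.Bool.Properties using (not-involutive)
open import Data.Bool using (Bool; true; false; _∧_; not; if_then_else_)
open import Data.Integer using (_+_; -_; +≤+; +<+; _≤_; _<_; _≤?_; _<?_)
import Data.Integer.Properties as ℤ
open import Data.Integer.Tactic.RingSolver using (solve-∀)
open import Data.List using ([]; _∷_; _++_; concatMap; applyUpTo; length)
open import Data.List.Properties using (map-++)
import Data.Nat as ℕ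
import Data.Nat.Properties as ℕ
open import Data.Product using (_,_)
open import Data.Sum using (_⊎_; inj₁; inj₂; map₁; map₂)
open import Data.Unit using (⊤; tt)
open import Function using (_∘_)
open import Relation.Binary.PropositionalEquality using (refl; sym; trans; cong; cong₂; subst; module ≡-Reasoning)
open import Relation.Nullary using (Dec; does; yes; no; contradiction)
open import Relation.Nullary.Reflects using (ofʸ; ofⁿ)
open ≡-Reasoning

⟦_⟧ : Bool → ℤ
⟦ true ⟧ = + 1
⟦ false ⟧ = + 0

⟦∧⟧ : ∀ x y → ⟦ x ∧ y ⟧ ≡ ⟦ x ⟧ * ⟦ y ⟧
⟦∧⟧ true y = sym (ℤ.*-identityˡ ⟦ y ⟧)
⟦∧⟧ false y = sym (ℤ.*-zeroˡ ⟦ y ⟧)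

⟦∧⟧₄ : ∀ w x y z → ⟦ w ∧ x ∧ y ∧ z ⟧ ≡ ⟦ w ⟧ * (⟦ x ⟧ * (⟦ y ⟧ * ⟦ z ⟧))
⟦∧⟧₄ w x y z = trans (⟦∧⟧ w _) (cong (⟦ w ⟧ *_) (trans (⟦∧⟧ x _) (cong (⟦ x ⟧ *_) (⟦∧⟧ y z))))

∑ : {A : Set} → List A → (A → ℤ) → ℤ
∑ xs f = sumℤ (map f xs)

syntax ∑ xs (λ x → e) = ∑[ x ← xs ] e

private variable A B : Set

sumℤ-++ : (xs ys : List ℤ) → sumℤ (xs ++ ys) ≡ sumℤ xs + sumℤ ys
sumℤ-++ [] ys = sym (ℤ.+-identityˡ _)
sumℤ-++ (x ∷ xs) ys = trans (cong (_+_ x) (sumℤ-++ xs ys)) (sym (ℤ.+-assoc x _ _))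

∑-cong : ∀ {f g : A → ℤ} xs → (∀ x → f x ≡ g x) → ∑ xs f ≡ ∑ xs g
∑-cong [] f≗g = refl
∑-cong (x ∷ xs) f≗g = cong₂ _+_ (f≗g x) (∑-cong xs f≗g)

∑-map : ∀ (h : A → B) (f : B → ℤ) xs → ∑ (map h xs) f ≡ ∑ xs (f ∘ h)
∑-map h f [] = refl
∑-map h f (x ∷ xs) = cong (_+_ (f (h x))) (∑-map h f xs)

∑-concatMap : ∀ (g : A → List B) (f : B → ℤ) xs →
  ∑ (concatMap g xs) f ≡ ∑[ x ← xs ] ∑ (g x) f
∑-concatMap g f [] = refl
∑-concatMap g f (x ∷ xs) = begin
  sumℤ (map f (g x ++ concatMap g xs))         ≡⟨ cong sumℤ (map-++ f (g x) _) ⟩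
  sumℤ (map f (g x) ++ map f (concatMap g xs)) ≡⟨ sumℤ-++ (map f (g x)) _ ⟩
  ∑ (g x) f + ∑ (concatMap g xs) f             ≡⟨ cong (_+_ (∑ (g x) f)) (∑-concatMap g f xs) ⟩
  ∑ (g x) f + ∑[ x ← xs ] ∑ (g x) f            ∎

∑-zero : ∀ (xs : List A) → ∑[ x ← xs ] (+ 0) ≡ + 0
∑-zero [] = refl
∑-zero (x ∷ xs) = trans (ℤ.+-identityˡ _) (∑-zero xs)

∑-+ : ∀ (f g : A → ℤ) xs → ∑[ x ← xs ] (f x + g x) ≡ ∑ xs f + ∑ xs g
∑-+ f g [] = refl
∑-+ f g (x ∷ xs) =
  trans (cong (_+_ (f x + g x)) (∑-+ f g xs)) (interchange (f x) (g x) (∑ xs f) (∑ xs g))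
  where
  interchange : ∀ a b c d → a + b + (c + d) ≡ a + c + (b + d)
  interchange = solve-∀

∑-*ˡ : ∀ k (f : A → ℤ) xs → ∑[ x ← xs ] (k * f x) ≡ k * ∑ xs f
∑-*ˡ k f [] = sym (ℤ.*-zeroʳ k)
∑-*ˡ k f (x ∷ xs) =
  trans (cong (_+_ (k * f x)) (∑-*ˡ k f xs)) (sym (ℤ.*-distribˡ-+ k (f x) _))

∑-*ʳ : ∀ k (f : A → ℤ) xs → ∑[ x ← xs ] (f x * k) ≡ ∑ xs f * k
∑-*ʳ k f xs = begin
  ∑[ x ← xs ] (f x * k) ≡⟨ ∑-cong xs (λ x → ℤ.*-comm (f x) k) ⟩
  ∑[ x ← xs ] (k * f x) ≡⟨ ∑-*ˡ k f xs ⟩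
  k * ∑ xs f            ≡⟨ ℤ.*-comm k _ ⟩
  ∑ xs f * k            ∎

∑-product : ∀ (f : A → ℤ) (g : B → ℤ) xs ys →
  ∑[ x ← xs ] ∑[ y ← ys ] (f x * g y) ≡ ∑ xs f * ∑ ys g
∑-product f g xs ys =
  trans (∑-cong xs (λ x → ∑-*ˡ (f x) g ys)) (∑-*ʳ (∑ ys g) f xs)

∑-swap : ∀ (f : A → B → ℤ) xs ys →
  ∑[ x ← xs ] ∑[ y ← ys ] f x y ≡ ∑[ y ← ys ] ∑[ x ← xs ] f x y
∑-swap f [] ys = sym (∑-zero ys)
∑-swap f (x ∷ xs) ys =
  trans (cong (_+_ (∑ ys (f x))) (∑-swap f xs ys)) (sym (∑-+ (f x) _ ys))

countB≡∑ : ∀ (p : A → Bool) xs → + countB p xs ≡ ∑[ x ← xs ] ⟦ p x ⟧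
countB≡∑ p [] = refl
countB≡∑ p (x ∷ xs) with p x
... | true = cong (_+_ (+ 1)) (countB≡∑ p xs)
... | false = trans (countB≡∑ p xs) (sym (ℤ.+-identityˡ _))

∑-filterB : ∀ (p : A → Bool) (f : A → ℤ) xs → ∑ (filterB p xs) f ≡ ∑[ x ← xs ] (⟦ p x ⟧ * f x)
∑-filterB p f [] = refl
∑-filterB p f (x ∷ xs) with p x
... | true = cong₂ _+_ (sym (ℤ.*-identityˡ (f x))) (∑-filterB p f xs)
... | false = trans (∑-filterB p f xs) (sym (ℤ.+-identityˡ _))

countB-++ : ∀ (p : A → Bool) xs ys → countB p (xs ++ ys) ≡ countB p xs ℕ.+ countB p ys
countB-++ p [] ys = refl
countB-++ p (x ∷ xs) ys with p x
... | true = cong ℕ.suc (countB-++ p xs ys)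
... | false = countB-++ p xs ys

countB-expansion : ∀ (K : List A) (Ls : List B) (P E : A → Bool) (C : B → A → Bool) (w : B → ℤ) →
  (∀ κ → ⟦ P κ ⟧ ≡ ∑[ L ← Ls ] (w L * ⟦ C L κ ⟧)) →
  + countB (λ κ → P κ ∧ E κ) K ≡ ∑[ L ← Ls ] (w L * + countB (λ κ → C L κ ∧ E κ) K)
countB-expansion K Ls P E C w P≡∑ = begin
  + countB (λ κ → P κ ∧ E κ) K
    ≡⟨ countB≡∑ _ K ⟩
  ∑[ κ ← K ] ⟦ P κ ∧ E κ ⟧
    ≡⟨ ∑-cong K (λ κ → trans (⟦∧⟧ (P κ) (E κ)) (cong (_* ⟦ E κ ⟧) (P≡∑ κ))) ⟩
  ∑[ κ ← K ] (∑[ L ← Ls ] (w L * ⟦ C L κ ⟧) * ⟦ E κ ⟧)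
    ≡⟨ ∑-cong K (λ κ → sym (∑-*ʳ ⟦ E κ ⟧ _ Ls)) ⟩
  ∑[ κ ← K ] ∑[ L ← Ls ] (w L * ⟦ C L κ ⟧ * ⟦ E κ ⟧)
    ≡⟨ ∑-swap _ K Ls ⟩
  ∑[ L ← Ls ] ∑[ κ ← K ] (w L * ⟦ C L κ ⟧ * ⟦ E κ ⟧)
    ≡⟨ ∑-cong Ls (λ L → ∑-cong K (λ κ → trans (ℤ.*-assoc (w L) _ _) (cong (w L *_) (sym (⟦∧⟧ (C L κ) (E κ)))))) ⟩
  ∑[ L ← Ls ] ∑[ κ ← K ] (w L * ⟦ C L κ ∧ E κ ⟧)
    ≡⟨ ∑-cong Ls (λ L → trans (∑-*ˡ (w L) _ K) (cong (w L *_) (sym (countB≡∑ _ K)))) ⟩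
  ∑[ L ← Ls ] (w L * + countB (λ κ → C L κ ∧ E κ) K) ∎

sign-+ : ∀ m n → sign (m ℕ.+ n) ≡ sign m * sign n
sign-+ ℕ.zero n = sym (ℤ.*-identityˡ _)
sign-+ (ℕ.suc m) n = trans (cong -_ (sign-+ m n)) (ℤ.neg-distribˡ-* (sign m) (sign n))

*-cong-unless-zero : ∀ x {y z} → x ≡ + 0 ⊎ y ≡ z → x * y ≡ x * z
*-cong-unless-zero _ {y} {z} (inj₁ refl) = trans (ℤ.*-zeroˡ y) (sym (ℤ.*-zeroˡ z))
*-cong-unless-zero _ (inj₂ refl) = refl

zero-product : ∀ c x y → x ≡ + 0 ⊎ y ≡ + 0 → c * (x * y) ≡ + 0
zero-product c _ y (inj₁ refl) = trans (cong (c *_) (ℤ.*-zeroˡ y)) (ℤ.*-zeroʳ c)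
zero-product c x _ (inj₂ refl) = trans (cong (c *_) (ℤ.*-zeroʳ x)) (ℤ.*-zeroʳ c)

<⇒+suc≤ : ∀ {s a} n → s + + n < a → s + + ℕ.suc n ≤ a
<⇒+suc≤ {s} n s+n<a = subst (_≤ _) (shift s (+ n)) (ℤ.i<j⇒suc[i]≤j s+n<a)
  where
  shift : ∀ s x → + 1 + (s + x) ≡ s + (+ 1 + x)
  shift = solve-∀

<ᵇ≡not≤ᵇ : ∀ m n → (m ℕ.<ᵇ n) ≡ not (n ℕ.≤ᵇ m)
<ᵇ≡not≤ᵇ m n with m ℕ.<ᵇ n | ℕ.<ᵇ-reflects-< m n | n ℕ.≤ᵇ m | ℕ.≤ᵇ-reflects-≤ n m
... | true  | _        | false | _        = refl
... | false | _        | true  | _        = refl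
... | true  | ofʸ m<n  | true  | ofʸ n≤m  = contradiction n≤m (ℕ.<⇒≱ m<n)
... | false | ofⁿ m≮n  | false | ofⁿ n≰m  = contradiction (ℕ.≮⇒≥ m≮n) n≰m

≤ᵇ≡not<ᵇ : ∀ m n → (m ℕ.≤ᵇ n) ≡ not (n ℕ.<ᵇ m)
≤ᵇ≡not<ᵇ m n = trans (sym (not-involutive (m ℕ.≤ᵇ n))) (cong not (sym (<ᵇ≡not≤ᵇ n m)))

private variable t l r : Tree

markings : (t : Tree) → List (Deco Bool t)
markings = allDeco (true ∷ false ∷ [])

markedT : Deco Bool t → ℕ
markedT m = countB (λ b → b) (valuesT m)

sign-markedT : ∀ (ml : Deco Bool l) b (mr : Deco Bool r) →
  sign (markedT (nd ml b mr)) ≡ sign (markedT ml) * sign (countB (λ b → b) (b ∷ valuesT mr))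
sign-markedT ml b mr =
  trans (cong sign (countB-++ (λ b → b) (valuesT ml) (b ∷ valuesT mr))) (sign-+ (markedT ml) _)

weight : Deco ℕ t → Deco ℤ t → Deco Bool t → ℤ
weight κ ρ m = ⟦ isIdealT m ⟧ * (sign (markedT m) * ⟦ compatT m κ ρ ⟧)

Ψ : Deco ℕ t → Deco ℤ t → ℤ
Ψ {t} κ ρ = ∑ (markings t) (weight κ ρ)

rootMarked : Bool → (Deco Bool (node l r) → ℤ) → ℤ
rootMarked {l} {r} b f = ∑[ ml ← markings l ] ∑[ mr ← markings r ] f (nd ml b mr)

∑-markings-node : ∀ (f : Deco Bool (node l r) → ℤ) →
  ∑ (markings (node l r)) f ≡ rootMarked true f + rootMarked false f
∑-markings-node {l} {r} f = begin
  ∑ (markings (node l r)) f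
    ≡⟨ ∑-concatMap _ f (markings l) ⟩
  ∑[ ml ← markings l ] ∑ (concatMap (λ b → map (nd ml b) (markings r)) (true ∷ false ∷ [])) f
    ≡⟨ ∑-cong (markings l) (λ ml → ∑-concatMap (λ b → map (nd ml b) (markings r)) f (true ∷ false ∷ [])) ⟩
  ∑[ ml ← markings l ] (∑ (map (nd ml true) (markings r)) f
                          + (∑ (map (nd ml false) (markings r)) f + + 0))
    ≡⟨ ∑-cong (markings l) (λ ml → cong₂ _+_ (∑-map (nd ml true) f (markings r))
                                             (trans (ℤ.+-identityʳ _) (∑-map (nd ml false) f (markings r)))) ⟩
  ∑[ ml ← markings l ] (∑[ mr ← markings r ] f (nd ml true mr) + ∑[ mr ← markings r ] f (nd ml false mr))
    ≡⟨ ∑-+ _ _ (markings l) ⟩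
  rootMarked true f + rootMarked false f ∎

rootMarked-*ˡ : ∀ b k (f : Deco Bool (node l r) → ℤ) → rootMarked b (λ m → k * f m) ≡ k * rootMarked b f
rootMarked-*ˡ {l} {r} b k f =
  trans (∑-cong (markings l) (λ ml → ∑-*ˡ k (λ mr → f (nd ml b mr)) (markings r)))
        (∑-*ˡ k _ (markings l))

-- Ψ κ ρ = Σ_L (-1)^|L| [κ is L-compatible] over the lower ideals L of one tree (other
-- markings have weight 0); Ψ∈ and Ψ∉ keep the L containing, resp. not containing, the root.
-- The empty marking of a leaf counts as containing the root (childInL lf = true).
Ψ∈ Ψ∉ : Deco ℕ t → Deco ℤ t → ℤ
Ψ∈ {leaf} _ _ = + 1
Ψ∈ {node l r} κ ρ = rootMarked true (weight κ ρ)
Ψ∉ {leaf} _ _ = + 0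
Ψ∉ {node l r} κ ρ = rootMarked false (weight κ ρ)

Ψ-split : ∀ (κ : Deco ℕ t) ρ → Ψ κ ρ ≡ Ψ∈ κ ρ + Ψ∉ κ ρ
Ψ-split {leaf} lf lf = refl
Ψ-split {node l r} κ ρ = ∑-markings-node (weight κ ρ)

rootCase : Bool → Bool → Deco Bool t → Bool
rootCase p q m = if childInL m then p else q

∑-rootCase : ∀ (κ : Deco ℕ t) ρ p q →
  ∑[ m ← markings t ] (⟦ rootCase p q m ⟧ * weight κ ρ m) ≡ ⟦ p ⟧ * Ψ∈ κ ρ + ⟦ q ⟧ * Ψ∉ κ ρ
∑-rootCase {leaf} lf lf p q = leafCase ⟦ p ⟧ ⟦ q ⟧
  where
  leafCase : ∀ x y → x * + 1 + + 0 ≡ x * + 1 + y * + 0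
  leafCase = solve-∀
∑-rootCase {node l r} κ ρ p q =
  trans (∑-markings-node (λ m → ⟦ rootCase p q m ⟧ * weight κ ρ m))
        (cong₂ _+_ (rootMarked-*ˡ true ⟦ p ⟧ (weight κ ρ)) (rootMarked-*ˡ false ⟦ q ⟧ (weight κ ρ)))

-- The edge conditions inside L are the negations of those inside U.
leftLT rightLE : ℕ → Deco ℕ t → Bool
leftLT a lf = true
leftLT a (nd _ b _) = not (a ℕ.≤ᵇ b)
rightLE a lf = true
rightLE a (nd _ b _) = not (a ℕ.<ᵇ b)

leftEdge-∉ : ∀ a (m : Deco Bool t) κ → leftEdge false a m κ ≡ rootCase true (leftGE a κ) m
leftEdge-∉ a lf lf = refl
leftEdge-∉ a (nd _ true _) (nd _ _ _) = refl
leftEdge-∉ a (nd _ false _) (nd _ _ _) = refl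

rightEdge-∉ : ∀ a (m : Deco Bool t) κ → rightEdge false a m κ ≡ rootCase true (rightGT a κ) m
rightEdge-∉ a lf lf = refl
rightEdge-∉ a (nd _ true _) (nd _ _ _) = refl
rightEdge-∉ a (nd _ false _) (nd _ _ _) = refl

leftEdge-∈ : ∀ a (m : Deco Bool t) κ → childInL m ∧ leftEdge true a m κ ≡ rootCase (leftLT a κ) false m
leftEdge-∈ a lf lf = refl
leftEdge-∈ a (nd _ true _) (nd _ b _) = <ᵇ≡not≤ᵇ b a
leftEdge-∈ a (nd _ false _) (nd _ _ _) = refl

rightEdge-∈ : ∀ a (m : Deco Bool t) κ → childInL m ∧ rightEdge true a m κ ≡ rootCase (rightLE a κ) false m
rightEdge-∈ a lf lf = refl
rightEdge-∈ a (nd _ true _) (nd _ b _) = ≤ᵇ≡not<ᵇ b a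
rightEdge-∈ a (nd _ false _) (nd _ _ _) = refl

module _ (κl : Deco ℕ l) (a : ℕ) (κr : Deco ℕ r) (ρl : Deco ℤ l) (ρv : ℤ) (ρr : Deco ℤ r) where

  weight-root∉ : ∀ ml mr →
    weight (nd κl a κr) (nd ρl ρv ρr) (nd ml false mr)
      ≡ (⟦ rootCase true (leftGE a κl) ml ⟧ * weight κl ρl ml)
        * (⟦ rootCase true (rightGT a κr) mr ⟧ * weight κr ρr mr)
  weight-root∉ ml mr = begin
    ⟦ iL ∧ iR ⟧ * (sign (markedT (nd ml false mr)) * ⟦ eL ∧ eR ∧ cL ∧ cR ⟧)
      ≡⟨ cong₂ _*_ (⟦∧⟧ iL iR) (cong₂ _*_ (sign-markedT ml false mr) (⟦∧⟧₄ eL eR cL cR)) ⟩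
    (⟦ iL ⟧ * ⟦ iR ⟧) * ((sL * sR) * (⟦ eL ⟧ * (⟦ eR ⟧ * (⟦ cL ⟧ * ⟦ cR ⟧))))
      ≡⟨ regroup ⟦ iL ⟧ ⟦ iR ⟧ sL sR ⟦ eL ⟧ ⟦ eR ⟧ ⟦ cL ⟧ ⟦ cR ⟧ ⟩
    (⟦ eL ⟧ * weight κl ρl ml) * (⟦ eR ⟧ * weight κr ρr mr)
      ≡⟨ cong₂ (λ x y → (⟦ x ⟧ * weight κl ρl ml) * (⟦ y ⟧ * weight κr ρr mr))
               (leftEdge-∉ a ml κl) (rightEdge-∉ a mr κr) ⟩
    (⟦ rootCase true (leftGE a κl) ml ⟧ * weight κl ρl ml)
      * (⟦ rootCase true (rightGT a κr) mr ⟧ * weight κr ρr mr) ∎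
    where
    iL = isIdealT ml
    iR = isIdealT mr
    eL = leftEdge false a ml κl
    eR = rightEdge false a mr κr
    cL = compatT ml κl ρl
    cR = compatT mr κr ρr
    sL = sign (markedT ml)
    sR = sign (markedT mr)
    regroup : ∀ i i′ s s′ e e′ c c′ →
      (i * i′) * ((s * s′) * (e * (e′ * (c * c′)))) ≡ (e * (i * (s * c))) * (e′ * (i′ * (s′ * c′)))
    regroup = solve-∀

  weight-root∈ : ∀ ml mr →
    weight (nd κl a κr) (nd ρl ρv ρr) (nd ml true mr)
      ≡ - ⟦ ρv <ℤ (+ a) ⟧ * ((⟦ rootCase (leftLT a κl) false ml ⟧ * weight κl ρl ml)
                           * (⟦ rootCase (rightLE a κr) false mr ⟧ * weight κr ρr mr))
  weight-root∈ ml mr = begin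
    ⟦ (dL ∧ dR) ∧ iL ∧ iR ⟧ * (sign (markedT (nd ml true mr)) * ⟦ p ∧ eL ∧ eR ∧ cL ∧ cR ⟧)
      ≡⟨ cong₂ _*_ (trans (⟦∧⟧ (dL ∧ dR) _) (cong₂ _*_ (⟦∧⟧ dL dR) (⟦∧⟧ iL iR)))
           (cong₂ _*_ (sign-markedT ml true mr) (trans (⟦∧⟧ p _) (cong (⟦ p ⟧ *_) (⟦∧⟧₄ eL eR cL cR)))) ⟩
    ((⟦ dL ⟧ * ⟦ dR ⟧) * (⟦ iL ⟧ * ⟦ iR ⟧))
      * ((sL * - sR) * (⟦ p ⟧ * (⟦ eL ⟧ * (⟦ eR ⟧ * (⟦ cL ⟧ * ⟦ cR ⟧)))))
      ≡⟨ regroup ⟦ dL ⟧ ⟦ dR ⟧ ⟦ iL ⟧ ⟦ iR ⟧ sL sR ⟦ p ⟧ ⟦ eL ⟧ ⟦ eR ⟧ ⟦ cL ⟧ ⟦ cR ⟧ ⟩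
    - ⟦ p ⟧ * (((⟦ dL ⟧ * ⟦ eL ⟧) * weight κl ρl ml) * ((⟦ dR ⟧ * ⟦ eR ⟧) * weight κr ρr mr))
      ≡⟨ cong₂ (λ x y → - ⟦ p ⟧ * ((x * weight κl ρl ml) * (y * weight κr ρr mr)))
               (trans (sym (⟦∧⟧ dL eL)) (cong ⟦_⟧ (leftEdge-∈ a ml κl)))
               (trans (sym (⟦∧⟧ dR eR)) (cong ⟦_⟧ (rightEdge-∈ a mr κr))) ⟩
    - ⟦ p ⟧ * ((⟦ rootCase (leftLT a κl) false ml ⟧ * weight κl ρl ml)
               * (⟦ rootCase (rightLE a κr) false mr ⟧ * weight κr ρr mr)) ∎
    where
    p = ρv <ℤ (+ a)
    dL = childInL ml
    dR = childInL mr
    iL = isIdealT ml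
    iR = isIdealT mr
    eL = leftEdge true a ml κl
    eR = rightEdge true a mr κr
    cL = compatT ml κl ρl
    cR = compatT mr κr ρr
    sL = sign (markedT ml)
    sR = sign (markedT mr)
    regroup : ∀ d d′ i i′ s s′ q e e′ c c′ →
      ((d * d′) * (i * i′)) * ((s * - s′) * (q * (e * (e′ * (c * c′)))))
        ≡ - q * (((d * e) * (i * (s * c))) * ((d′ * e′) * (i′ * (s′ * c′))))
    regroup = solve-∀

  Ψ∉-node : Ψ∉ (nd κl a κr) (nd ρl ρv ρr)
            ≡ (Ψ∈ κl ρl + ⟦ leftGE a κl ⟧ * Ψ∉ κl ρl) * (Ψ∈ κr ρr + ⟦ rightGT a κr ⟧ * Ψ∉ κr ρr)
  Ψ∉-node = begin
    rootMarked false (weight (nd κl a κr) (nd ρl ρv ρr))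
      ≡⟨ ∑-cong (markings l) (λ ml → ∑-cong (markings r) (weight-root∉ ml)) ⟩
    ∑[ ml ← markings l ] ∑[ mr ← markings r ] (wL ml * wR mr)
      ≡⟨ ∑-product wL wR (markings l) (markings r) ⟩
    ∑ (markings l) wL * ∑ (markings r) wR
      ≡⟨ cong₂ _*_ (∑-rootCase κl ρl true (leftGE a κl)) (∑-rootCase κr ρr true (rightGT a κr)) ⟩
    (+ 1 * Ψ∈ κl ρl + ⟦ leftGE a κl ⟧ * Ψ∉ κl ρl) * (+ 1 * Ψ∈ κr ρr + ⟦ rightGT a κr ⟧ * Ψ∉ κr ρr)
      ≡⟨ cong₂ (λ x y → (x + ⟦ leftGE a κl ⟧ * Ψ∉ κl ρl) * (y + ⟦ rightGT a κr ⟧ * Ψ∉ κr ρr))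
               (ℤ.*-identityˡ (Ψ∈ κl ρl)) (ℤ.*-identityˡ (Ψ∈ κr ρr)) ⟩
    (Ψ∈ κl ρl + ⟦ leftGE a κl ⟧ * Ψ∉ κl ρl) * (Ψ∈ κr ρr + ⟦ rightGT a κr ⟧ * Ψ∉ κr ρr) ∎
    where
    wL = λ ml → ⟦ rootCase true (leftGE a κl) ml ⟧ * weight κl ρl ml
    wR = λ mr → ⟦ rootCase true (rightGT a κr) mr ⟧ * weight κr ρr mr

  Ψ∈-node : Ψ∈ (nd κl a κr) (nd ρl ρv ρr)
            ≡ - ⟦ ρv <ℤ (+ a) ⟧ * ((⟦ leftLT a κl ⟧ * Ψ∈ κl ρl) * (⟦ rightLE a κr ⟧ * Ψ∈ κr ρr))
  Ψ∈-node = begin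
    rootMarked true (weight (nd κl a κr) (nd ρl ρv ρr))
      ≡⟨ ∑-cong (markings l) (λ ml → ∑-cong (markings r) (weight-root∈ ml)) ⟩
    rootMarked true (λ m → c * product m)
      ≡⟨ rootMarked-*ˡ true c product ⟩
    c * ∑[ ml ← markings l ] ∑[ mr ← markings r ] (wL ml * wR mr)
      ≡⟨ cong (c *_) (∑-product wL wR (markings l) (markings r)) ⟩
    c * (∑ (markings l) wL * ∑ (markings r) wR)
      ≡⟨ cong (c *_) (cong₂ _*_ (∑-rootCase κl ρl (leftLT a κl) false)
                                      (∑-rootCase κr ρr (rightLE a κr) false)) ⟩
    c * ((⟦ leftLT a κl ⟧ * Ψ∈ κl ρl + + 0 * Ψ∉ κl ρl) * (⟦ rightLE a κr ⟧ * Ψ∈ κr ρr + + 0 * Ψ∉ κr ρr))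
      ≡⟨ drop-zero c (⟦ leftLT a κl ⟧ * Ψ∈ κl ρl) (Ψ∉ κl ρl) (⟦ rightLE a κr ⟧ * Ψ∈ κr ρr) (Ψ∉ κr ρr) ⟩
    c * ((⟦ leftLT a κl ⟧ * Ψ∈ κl ρl) * (⟦ rightLE a κr ⟧ * Ψ∈ κr ρr)) ∎
    where
    c = - ⟦ ρv <ℤ (+ a) ⟧
    wL = λ ml → ⟦ rootCase (leftLT a κl) false ml ⟧ * weight κl ρl ml
    wR = λ mr → ⟦ rootCase (rightLE a κr) false mr ⟧ * weight κr ρr mr
    product : Deco Bool (node l r) → ℤ
    product (nd ml _ mr) = wL ml * wR mr
    drop-zero : ∀ c x y x′ y′ → c * ((x + + 0 * y) * (x′ + + 0 * y′)) ≡ c * (x * x′)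
    drop-zero = solve-∀

Ψ∈+⟦⟧*Ψ∉ : ∀ (κ : Deco ℕ t) ρ e → Ψ∈ κ ρ + ⟦ e ⟧ * Ψ∉ κ ρ ≡ (if e then Ψ κ ρ else Ψ∈ κ ρ)
Ψ∈+⟦⟧*Ψ∉ κ ρ true = trans (cong (_+_ (Ψ∈ κ ρ)) (ℤ.*-identityˡ _)) (sym (Ψ-split κ ρ))
Ψ∈+⟦⟧*Ψ∉ κ ρ false = trans (cong (_+_ (Ψ∈ κ ρ)) (ℤ.*-zeroˡ (Ψ∉ κ ρ))) (ℤ.+-identityʳ _)

infix 4 _≤root_
_≤root_ : ℤ → Deco ℕ t → Set
c ≤root lf = ⊤
c ≤root nd _ a _ = c ≤ + a

leftFactor-≤ : ∀ {c a} (κ : Deco ℕ t) ρ → + a ≤ c → Ψ∈ κ ρ ≡ + 0 ⊎ c ≤root κ →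
  Ψ∈ κ ρ + ⟦ leftGE a κ ⟧ * Ψ∉ κ ρ ≡ ⟦ leftGE a κ ⟧ * Ψ κ ρ
leftFactor-≤ lf lf _ _ = refl
leftFactor-≤ {a = a} κ@(nd _ b _) ρ a≤c bound
  rewrite Ψ∈+⟦⟧*Ψ∉ κ ρ (a ℕ.≤ᵇ b) with a ℕ.≤ᵇ b | ℕ.≤ᵇ-reflects-≤ a b
... | true | _ = sym (ℤ.*-identityˡ _)
... | false | ofⁿ a≰b with bound
...   | inj₁ Ψ∈≡0 = trans Ψ∈≡0 (sym (ℤ.*-zeroˡ (Ψ κ ρ)))
...   | inj₂ c≤b = contradiction (ℤ.drop‿+≤+ (ℤ.≤-trans a≤c c≤b)) a≰b

rightFactor-< : ∀ {c a} (κ : Deco ℕ t) ρ → + a < c → Ψ∈ κ ρ ≡ + 0 ⊎ c ≤root κ →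
  Ψ∈ κ ρ + ⟦ rightGT a κ ⟧ * Ψ∉ κ ρ ≡ ⟦ rightGT a κ ⟧ * Ψ κ ρ
rightFactor-< lf lf _ _ = refl
rightFactor-< {a = a} κ@(nd _ b _) ρ a<c bound
  rewrite Ψ∈+⟦⟧*Ψ∉ κ ρ (a ℕ.<ᵇ b) with a ℕ.<ᵇ b | ℕ.<ᵇ-reflects-< a b
... | true | _ = sym (ℤ.*-identityˡ (Ψ κ ρ))
... | false | ofⁿ a≮b with bound
...   | inj₁ Ψ∈≡0 = trans Ψ∈≡0 (sym (ℤ.*-zeroˡ (Ψ κ ρ)))
...   | inj₂ c≤b = contradiction (ℤ.drop‿+<+ (ℤ.<-≤-trans a<c c≤b)) a≮b

rho : ℤ → (t : Tree) → Deco ℤ t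
rho s t = leftChain (canon s t)

leftmost-canon : ∀ s l r → leftmost (canon s (node l r)) ≡ s
leftmost-canon s leaf r = ℤ.+-identityʳ s
leftmost-canon s (node ll lr) r = leftmost-canon s ll lr

+-size-node : ∀ s l r → s + + ℕ.suc (size l) + + size r ≡ s + + size (node l r)
+-size-node s l r =
  trans (ℤ.+-assoc s _ _) (cong (_+_ s) (sym (ℤ.pos-+ (ℕ.suc (size l)) (size r))))

forestCondT-root : ∀ s (κl : Deco ℕ l) b (κr : Deco ℕ r) →
  forestCondT (nd κl b κr) (rho s (node l r)) ≡ true → + b ≤ s
forestCondT-root {l} {r} s κl b κr fc with + b ≤? leftmost (canon s (node l r))
... | yes b≤ρ = subst (+ b ≤_) (leftmost-canon s l r) b≤ρ

leftFactor-> : ∀ {a} s (κ : Deco ℕ t) → s < + a → Ψ κ (rho s t) ≡ ⟦ forestCondT κ (rho s t) ⟧ →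
  Ψ∈ κ (rho s t) + ⟦ leftGE a κ ⟧ * Ψ∉ κ (rho s t) ≡ ⟦ leftLT a κ ⟧ * Ψ∈ κ (rho s t)
leftFactor-> s lf _ _ = refl
leftFactor-> {node l r} {a} s κ@(nd κl b κr) s<a Ψ≡fc
  rewrite Ψ∈+⟦⟧*Ψ∉ κ (rho s (node l r)) (a ℕ.≤ᵇ b) with a ℕ.≤ᵇ b | ℕ.≤ᵇ-reflects-≤ a b
... | false | _ = sym (ℤ.*-identityˡ (Ψ∈ κ (rho s (node l r))))
... | true | ofʸ a≤b with forestCondT κ (rho s (node l r)) in fc
...   | false = trans Ψ≡fc (sym (ℤ.*-zeroˡ (Ψ∈ κ (rho s (node l r)))))
...   | true = contradiction (+≤+ a≤b) (ℤ.<⇒≱ (ℤ.≤-<-trans (forestCondT-root s κl b κr fc) s<a))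

rightFactor-≥ : ∀ {a} s (κ : Deco ℕ t) → s ≤ + a → Ψ κ (rho s t) ≡ ⟦ forestCondT κ (rho s t) ⟧ →
  Ψ∈ κ (rho s t) + ⟦ rightGT a κ ⟧ * Ψ∉ κ (rho s t) ≡ ⟦ rightLE a κ ⟧ * Ψ∈ κ (rho s t)
rightFactor-≥ s lf _ _ = refl
rightFactor-≥ {node l r} {a} s κ@(nd κl b κr) s≤a Ψ≡fc
  rewrite Ψ∈+⟦⟧*Ψ∉ κ (rho s (node l r)) (a ℕ.<ᵇ b) with a ℕ.<ᵇ b | ℕ.<ᵇ-reflects-< a b
... | false | _ = sym (ℤ.*-identityˡ (Ψ∈ κ (rho s (node l r))))
... | true | ofʸ a<b with forestCondT κ (rho s (node l r)) in fc
...   | false = trans Ψ≡fc (sym (ℤ.*-zeroˡ (Ψ∈ κ (rho s (node l r)))))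
...   | true = contradiction (+<+ a<b) (ℤ.≤⇒≯ (ℤ.≤-trans (forestCondT-root s κl b κr fc) s≤a))

left-step : ∀ {c a d} (κ : Deco ℕ t) → c < + a → d ≡ + 0 ⊎ c + + size t ≤root κ →
  ⟦ leftLT a κ ⟧ * d ≡ + 0 ⊎ c + + size t < + a
left-step {c = c} lf c<a _ = inj₂ (subst (_< _) (sym (ℤ.+-identityʳ c)) c<a)
left-step {a = a} {d} (nd _ b _) _ bound with a ℕ.≤ᵇ b | ℕ.≤ᵇ-reflects-≤ a b
... | true | _ = inj₁ (ℤ.*-zeroˡ d)
... | false | ofⁿ a≰b with bound
...   | inj₁ d≡0 = inj₁ (trans (ℤ.*-identityˡ d) d≡0)
...   | inj₂ c≤b = inj₂ (ℤ.≤-<-trans c≤b (+<+ (ℕ.≰⇒> a≰b)))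

right-step : ∀ {c a d} (κ : Deco ℕ t) → c ≤ + a → d ≡ + 0 ⊎ c + + size t ≤root κ →
  ⟦ rightLE a κ ⟧ * d ≡ + 0 ⊎ c + + size t ≤ + a
right-step {c = c} lf c≤a _ = inj₂ (subst (_≤ _) (sym (ℤ.+-identityʳ c)) c≤a)
right-step {a = a} {d} (nd _ b _) _ bound with a ℕ.<ᵇ b | ℕ.<ᵇ-reflects-< a b
... | true | _ = inj₁ (ℤ.*-zeroˡ d)
... | false | ofⁿ a≮b with bound
...   | inj₁ d≡0 = inj₁ (trans (ℤ.*-identityˡ d) d≡0)
...   | inj₂ c≤b = inj₂ (ℤ.≤-trans c≤b (+≤+ (ℕ.≮⇒≥ a≮b)))

-- ρv stands for the root label of rho s (node l r), which equals s only propositionally.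
Ψ∈-bound-node : ∀ {s ρv} (κl : Deco ℕ l) a (κr : Deco ℕ r) ρl ρr → ρv ≡ s →
  Ψ∈ κl ρl ≡ + 0 ⊎ s + + size l ≤root κl →
  Ψ∈ κr ρr ≡ + 0 ⊎ s + + ℕ.suc (size l) + + size r ≤root κr →
  Ψ∈ (nd κl a κr) (nd ρl ρv ρr) ≡ + 0 ⊎ s + + size (node l r) ≤ + a
Ψ∈-bound-node {l} {r} {s} κl a κr ρl ρr refl boundL boundR =
  map₁ (trans (Ψ∈-node κl a κr ρl s ρr)) (vanish-or-bound (s <? + a))
  where
  Yl = ⟦ leftLT a κl ⟧ * Ψ∈ κl ρl
  Yr = ⟦ rightLE a κr ⟧ * Ψ∈ κr ρr
  vanish-or-bound : (s<a? : Dec (s < + a)) →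
    - ⟦ does s<a? ⟧ * (Yl * Yr) ≡ + 0 ⊎ s + + size (node l r) ≤ + a
  vanish-or-bound (no _) = inj₁ (ℤ.*-zeroˡ (Yl * Yr))
  vanish-or-bound (yes s<a) with left-step κl s<a boundL
  ... | inj₁ Yl≡0 = inj₁ (zero-product (- + 1) Yl Yr (inj₁ Yl≡0))
  ... | inj₂ s+l<a with right-step κr (<⇒+suc≤ {s} (size l) s+l<a) boundR
  ...   | inj₁ Yr≡0 = inj₁ (zero-product (- + 1) Yl Yr (inj₂ Yr≡0))
  ...   | inj₂ s+t≤a = inj₂ (subst (_≤ + a) (+-size-node s l r) s+t≤a)

Ψ∈-bound : ∀ s t (κ : Deco ℕ t) → Ψ∈ κ (rho s t) ≡ + 0 ⊎ s + + size t ≤root κ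
Ψ∈-bound s leaf lf = inj₂ tt
Ψ∈-bound s (node l r) (nd κl a κr) =
  Ψ∈-bound-node κl a κr (rho s l) (rho s′ r) (leftmost-canon s l r)
    (Ψ∈-bound s l κl) (Ψ∈-bound s′ r κr)
  where s′ = s + + ℕ.suc (size l)

module _ {s : ℤ} (κl : Deco ℕ l) (a : ℕ) (κr : Deco ℕ r)
         (Ψl≡fc : Ψ κl (rho s l) ≡ ⟦ forestCondT κl (rho s l) ⟧)
         (Ψr≡fc : Ψ κr (rho (s + + ℕ.suc (size l)) r) ≡ ⟦ forestCondT κr (rho (s + + ℕ.suc (size l)) r) ⟧)
         where

  private
    s′ = s + + ℕ.suc (size l)
    ρl = rho s l
    ρr = rho s′ r
    Xl = Ψ∈ κl ρl + ⟦ leftGE a κl ⟧ * Ψ∉ κl ρl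
    Xr = Ψ∈ κr ρr + ⟦ rightGT a κr ⟧ * Ψ∉ κr ρr
    Yl = ⟦ leftLT a κl ⟧ * Ψ∈ κl ρl
    Yr = ⟦ rightLE a κr ⟧ * Ψ∈ κr ρr
    gl = leftGE a κl
    gr = rightGT a κr
    fl = forestCondT κl ρl
    fr = forestCondT κr ρr

  unmarked-root-term : + a ≤ s → Xl * Xr ≡ ⟦ gl ∧ gr ∧ fl ∧ fr ⟧
  unmarked-root-term a≤s = begin
    Xl * Xr
      ≡⟨ cong₂ _*_ (leftFactor-≤ κl ρl a≤s+l (Ψ∈-bound s l κl))
                   (rightFactor-< κr ρr (ℤ.<-≤-trans a<s′ (ℤ.i≤i+j s′ (+ size r))) (Ψ∈-bound s′ r κr)) ⟩
    (⟦ gl ⟧ * Ψ κl ρl) * (⟦ gr ⟧ * Ψ κr ρr)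
      ≡⟨ cong₂ (λ x y → (⟦ gl ⟧ * x) * (⟦ gr ⟧ * y)) Ψl≡fc Ψr≡fc ⟩
    (⟦ gl ⟧ * ⟦ fl ⟧) * (⟦ gr ⟧ * ⟦ fr ⟧)
      ≡⟨ regroup ⟦ gl ⟧ ⟦ fl ⟧ ⟦ gr ⟧ ⟦ fr ⟧ ⟩
    ⟦ gl ⟧ * (⟦ gr ⟧ * (⟦ fl ⟧ * ⟦ fr ⟧))
      ≡⟨ sym (⟦∧⟧₄ gl gr fl fr) ⟩
    ⟦ gl ∧ gr ∧ fl ∧ fr ⟧ ∎
    where
    a≤s+l = ℤ.≤-trans a≤s (ℤ.i≤i+j s (+ size l))
    a<s′ = ℤ.≤-<-trans a≤s+l (ℤ.+-monoʳ-< s (+<+ (ℕ.n<1+n (size l))))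
    regroup : ∀ g f g′ f′ → (g * f) * (g′ * f′) ≡ g * (g′ * (f * f′))
    regroup = solve-∀

  root-terms-cancel : s < + a → Xl * Xr ≡ Yl * Yr
  root-terms-cancel s<a =
    trans (cong (_* Xr) (leftFactor-> s κl s<a Ψl≡fc))
          (*-cong-unless-zero Yl (map₂ Xr≡Yr (left-step κl s<a (Ψ∈-bound s l κl))))
    where
    Xr≡Yr : s + + size l < + a → Xr ≡ Yr
    Xr≡Yr s+l<a = rightFactor-≥ s′ κr (<⇒+suc≤ {s} (size l) s+l<a) Ψr≡fc

  Ψ-rho-node : ∀ {ρv} → ρv ≡ s →
    Ψ (nd κl a κr) (nd ρl ρv ρr) ≡ ⟦ forestCondT (nd κl a κr) (nd ρl ρv ρr) ⟧
  Ψ-rho-node refl = begin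
    Ψ κ ρ                                   ≡⟨ Ψ-split κ ρ ⟩
    Ψ∈ κ ρ + Ψ∉ κ ρ                         ≡⟨ cong₂ _+_ (Ψ∈-node κl a κr ρl s ρr) (Ψ∉-node κl a κr ρl s ρr) ⟩
    - ⟦ s <ℤ (+ a) ⟧ * (Yl * Yr) + Xl * Xr  ≡⟨ by-cases (s <? + a) (+ a ≤? s) ⟩
    ⟦ forestCondT κ ρ ⟧                      ∎
    where
    κ = nd κl a κr
    ρ = nd ρl s ρr
    by-cases : (s<a? : Dec (s < + a)) (a≤s? : Dec (+ a ≤ s)) →
      - ⟦ does s<a? ⟧ * (Yl * Yr) + Xl * Xr ≡ ⟦ does a≤s? ∧ gl ∧ gr ∧ fl ∧ fr ⟧
    by-cases (yes s<a) (yes a≤s) = contradiction a≤s (ℤ.<⇒≱ s<a)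
    by-cases (no s≮a) (no a≰s) = contradiction (ℤ.≮⇒≥ s≮a) a≰s
    by-cases (no _) (yes a≤s) =
      trans (cong (_+ Xl * Xr) (ℤ.*-zeroˡ (Yl * Yr))) (trans (ℤ.+-identityˡ _) (unmarked-root-term a≤s))
    by-cases (yes s<a) (no _) =
      trans (cong (_+_ (- + 1 * (Yl * Yr))) (root-terms-cancel s<a)) (cancel (Yl * Yr))
      where
      cancel : ∀ x → - + 1 * x + x ≡ + 0
      cancel = solve-∀

Ψ-rho : ∀ s t (κ : Deco ℕ t) → Ψ κ (rho s t) ≡ ⟦ forestCondT κ (rho s t) ⟧
Ψ-rho s leaf lf = refl
Ψ-rho s (node l r) (nd κl a κr) =
  Ψ-rho-node κl a κr (Ψ-rho s l κl) (Ψ-rho (s + + ℕ.suc (size l)) r κr) (leftmost-canon s l r)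

private variable F : RawForest

forestWeight : FDeco ℕ F → FDeco ℤ F → FDeco Bool F → ℤ
forestWeight κ ρ L = ⟦ isIdealF L ⟧ * (sign (card L) * ⟦ compatF L κ ρ ⟧)

forestMarkings : (F : RawForest) → List (FDeco Bool F)
forestMarkings = allFDeco (true ∷ false ∷ [])

Φ : FDeco ℕ F → FDeco ℤ F → ℤ
Φ {F} κ ρ = ∑ (forestMarkings F) (forestWeight κ ρ)

forestWeight-∷ : ∀ {s} (κ : Deco ℕ t) (κs : FDeco ℕ F) ρ ρs m ms →
  forestWeight {(s , t) ∷ F} (κ ∷ κs) (ρ ∷ ρs) (m ∷ ms) ≡ weight κ ρ m * forestWeight κs ρs ms
forestWeight-∷ κ κs ρ ρs m ms = begin
  ⟦ i ∧ is ⟧ * (sign (countB (λ b → b) (valuesT m ++ valuesF ms)) * ⟦ c ∧ cs ⟧)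
    ≡⟨ cong₂ _*_ (⟦∧⟧ i is) (cong₂ _*_ (trans (cong sign (countB-++ (λ b → b) (valuesT m) (valuesF ms)))
                                              (sign-+ (markedT m) (card ms)))
                                       (⟦∧⟧ c cs)) ⟩
  (⟦ i ⟧ * ⟦ is ⟧) * ((sign (markedT m) * sign (card ms)) * (⟦ c ⟧ * ⟦ cs ⟧))
    ≡⟨ regroup ⟦ i ⟧ ⟦ is ⟧ (sign (markedT m)) (sign (card ms)) ⟦ c ⟧ ⟦ cs ⟧ ⟩
  weight κ ρ m * forestWeight κs ρs ms ∎
  where
  i = isIdealT m
  is = isIdealF ms
  c = compatT m κ ρ
  cs = compatF ms κs ρs
  regroup : ∀ i i′ s s′ c c′ → (i * i′) * ((s * s′) * (c * c′)) ≡ (i * (s * c)) * (i′ * (s′ * c′))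
  regroup = solve-∀

Φ-∷ : ∀ {s} (κ : Deco ℕ t) (κs : FDeco ℕ F) ρ ρs →
  Φ {(s , t) ∷ F} (κ ∷ κs) (ρ ∷ ρs) ≡ Ψ κ ρ * Φ κs ρs
Φ-∷ {t} {F} {s} κ κs ρ ρs = begin
  ∑ (concatMap (λ m → map (m ∷_) (forestMarkings F)) (markings t)) w
    ≡⟨ ∑-concatMap _ w (markings t) ⟩
  ∑[ m ← markings t ] ∑ (map (m ∷_) (forestMarkings F)) w
    ≡⟨ ∑-cong (markings t) (λ m → ∑-map (m ∷_) w (forestMarkings F)) ⟩
  ∑[ m ← markings t ] ∑[ ms ← forestMarkings F ] w (m ∷ ms)
    ≡⟨ ∑-cong (markings t) (λ m → ∑-cong (forestMarkings F) (forestWeight-∷ {s = s} κ κs ρ ρs m)) ⟩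
  ∑[ m ← markings t ] ∑[ ms ← forestMarkings F ] (weight κ ρ m * forestWeight κs ρs ms)
    ≡⟨ ∑-product (weight κ ρ) (forestWeight κs ρs) (markings t) (forestMarkings F) ⟩
  Ψ κ ρ * Φ κs ρs ∎
  where
  w : FDeco Bool ((s , t) ∷ F) → ℤ
  w = forestWeight (κ ∷ κs) (ρ ∷ ρs)

Φ-rhoF : ∀ F (κ : FDeco ℕ F) → Φ κ (rhoF F) ≡ ⟦ forestCond F κ ⟧
Φ-rhoF [] [] = refl
Φ-rhoF ((s , t) ∷ F) (κ ∷ κs) = begin
  Φ (κ ∷ κs) (rho s t ∷ rhoF F)                          ≡⟨ Φ-∷ κ κs (rho s t) (rhoF F) ⟩
  Ψ κ (rho s t) * Φ κs (rhoF F)                          ≡⟨ cong₂ _*_ (Ψ-rho s t κ) (Φ-rhoF F κs) ⟩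
  ⟦ forestCondT κ (rho s t) ⟧ * ⟦ forestCond F κs ⟧      ≡⟨ sym (⟦∧⟧ (forestCondT κ (rho s t)) (forestCond F κs)) ⟩
  ⟦ forestCond ((s , t) ∷ F) (κ ∷ κs) ⟧                  ∎

forestCond-expansion : ∀ F (κ : FDeco ℕ F) →
  ⟦ forestCond F κ ⟧ ≡ ∑[ L ← lowerIdeals F ] (sign (card L) * ⟦ compatible F L κ ⟧)
forestCond-expansion F κ =
  sym (trans (∑-filterB isIdealF (λ L → sign (card L) * ⟦ compatible F L κ ⟧) (forestMarkings F)) (Φ-rhoF F κ))

theorem4p2 : (F : RawForest) → IsIndexedForest F → (α : List ℕ) →
    + coeff F (forestCond F) α
      ≡ sumℤ (map (λ L → sign (card L) * (+ coeff F (compatible F L) α)) (lowerIdeals F))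
theorem4p2 F _ α =
  countB-expansion (allFDeco (applyUpTo ℕ.suc (length α)) F) (lowerIdeals F)
    (forestCond F) (λ κ → eqListℕ (expVec (length α) (valuesF κ)) α)
    (compatible F) (λ L → sign (card L)) (forestCond-expansion F)
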